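{- If $G$ is a connected graph of order $n(G)$ whose complement $\overline{G}$ is also connected, then $$\chi_\mu(G)+\chi_\mu(\overline{G})\le\left\lceil\frac{n(G)+5}{2}\right\rceil.$$
   Context: For a connected graph $G$ and $S\subseteq V(G)$, two vertices $x,y\in S$ are $S$-visible if there is a shortest $x,y$-path $P$ in $G$ with $V(P)\cap S=\{x,y\}$. $S$ is a mutual-visibility set if any two vertices of $S$ are $S$-visible. A mutual-visibility coloring of $G$ is a partition of $V(G)$ into mutual-visibility sets, and the mutual-visibility chromatic number $\chi_\mu(G)$ is the smallest number of classes in such a partition. -}

module Defs where

open import Data.Nat using (ℕ; zero; suc; _≤_; _<_)
open import Data.Fin using (Fin)
open import Data.Fin.Properties using (_≟_)
open import Data.Bool using (Bool; true; false; not; _∧_)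
open import Data.List using (List; []; _∷_)
open import Data.List.Relation.Unary.All using (All)
open import Data.Product using (Σ; _×_; ∃)
open import Relation.Nullary using (¬_; does)
open import Relation.Binary.PropositionalEquality using (_≡_; _≢_)

record Graph (n : ℕ) : Set where
  field
    adj    : Fin n → Fin n → Bool
    adj-sym    : ∀ x y → adj x y ≡ adj y x
    adj-irrefl : ∀ x → adj x x ≡ false
open Graph public

complement : ∀ {n} → Graph n → Graph n
complement {n} G = record
  { adj = λ x y → not (adj G x y) ∧ not (does (x ≟ y))
  ; adj-sym = symC
  ; adj-irrefl = irrC
  }
  where
  open import Relation.Binary.PropositionalEquality using (refl; sym; cong)
  open import Relation.Nullary using (yes; no)
  symC : ∀ x y → (not (adj G x y) ∧ not (does (x ≟ y))) ≡ (not (adj G y x) ∧ not (does (y ≟ x)))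
  symC x y with x ≟ y | y ≟ x
  ... | yes _ | yes _ = cong (λ a → not a ∧ false) (Graph.adj-sym G x y)
  ... | no _  | no _  = cong (λ a → not a ∧ true) (Graph.adj-sym G x y)
  ... | yes p | no q  = Data.Empty.⊥-elim (q (sym p)) where import Data.Empty
  ... | no q  | yes p = Data.Empty.⊥-elim (q (sym p)) where import Data.Empty
  irrC : ∀ x → (not (adj G x x) ∧ not (does (x ≟ x))) ≡ false
  irrC x with x ≟ x
  ... | yes _ = Data.Bool.Properties.∧-zeroʳ (not (adj G x x)) where import Data.Bool.Properties
  ... | no ¬p = Data.Empty.⊥-elim (¬p refl) where import Data.Empty

data Walk {n : ℕ} (G : Graph n) : Fin n → Fin n → Set where
  []  : ∀ {x} → Walk G x x
  _∷_ : ∀ {x y z} → adj G x y ≡ true → Walk G y z → Walk G x z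

length : ∀ {n} {G : Graph n} {x z} → Walk G x z → ℕ
length []      = zero
length (_ ∷ w) = suc (length w)

interior : ∀ {n} {G : Graph n} {x z} → Walk G x z → List (Fin n)
interior []                   = []
interior (_ ∷ [])             = []
interior (_∷_ {y = y} _ (e ∷ w)) = y ∷ interior (e ∷ w)

Connected : ∀ {n} → Graph n → Set
Connected G = ∀ x y → Walk G x y

IsShortest : ∀ {n} {G : Graph n} {x y} → Walk G x y → Set
IsShortest {G = G} {x} {y} P = ∀ (Q : Walk G x y) → length P ≤ length Q

Subset : ℕ → Set₁
Subset n = Fin n → Set

Visible : ∀ {n} → Graph n → Subset n → Fin n → Fin n → Set
Visible G S x y = Σ (Walk G x y) λ P → IsShortest P × All (λ v → ¬ S v) (interior P)

IsMutualVisibility : ∀ {n} → Graph n → Subset n → Set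
IsMutualVisibility G S = ∀ x y → S x → S y → x ≢ y → Visible G S x y

IsMVColoring : ∀ {n} → Graph n → (k : ℕ) → (Fin n → Fin k) → Set
IsMVColoring G k c = ∀ (i : Fin _) → IsMutualVisibility G (λ v → c v ≡ i)

IsMVChromaticNumber : ∀ {n} → Graph n → ℕ → Set
IsMVChromaticNumber {n} G k =
  (Σ (Fin n → Fin k) (IsMVColoring G k)) ×
  (∀ j → j < k → ¬ Σ (Fin n → Fin j) (IsMVColoring G j))

-- Two vertices of a connected graph are always mutually visible, and a set S is a mutual-visibility set as soon
-- as any two nonadjacent vertices of S have a common neighbour outside S. Pairing up all vertices but one thus
-- gives χμ ≤ 1 + ⌊n/2⌋. If G has vertices x, y at distance at least 3, every vertex is a neighbour of x or of y in
-- Ḡ, so splitting V(Ḡ) by adjacency to x shows χμ(Ḡ) ≤ 2; likewise with G and Ḡ exchanged. Otherwise G and Ḡ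
-- both have diameter 2. Fix v and let M be its set of non-neighbours in G. If M spans an edge m₁m₂ of G, colour
-- N(v) and {v, m₁, m₂} with one colour each and pair up the rest of M; in Ḡ give M one colour and pair up
-- N[v]. Likewise if N(v) spans an edge of Ḡ. If neither happens, G is 2-coloured by membership in M. In each
-- case the two colourings use at most 3 + ⌊n/2⌋ = ⌈(n+5)/2⌉ colours.

module Submission where

open import Defs
open import Data.Nat using (ℕ; zero; suc; _+_; _*_; _≤_; _<_; z≤n; s≤s; _≤?_; ⌊_/2⌋; ⌈_/2⌉)
open import Data.Nat.DivMod using (_/_; m*n/n≡m; /-monoˡ-≤)
open import Data.Nat.Properties
  using (≤-refl; ≤-trans; ≤-reflexive; +-comm; <⇒≱; ≰⇒>; +-suc; +-monoʳ-≤; +-mono-≤;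
         suc-injective; 0≢1+n; n≤1+n; n<1+n; m<n⇒m<1+n; ⌊n/2⌋-mono; module ≤-Reasoning)
open import Data.Fin using (Fin; zero; suc; fromℕ<; _↑ˡ_; _↑ʳ_; splitAt)
open import Data.Fin.Properties
  using (_≟_; any?; fromℕ<-injective; ↑ˡ-injective; ↑ʳ-injective; splitAt-↑ˡ; splitAt-↑ʳ; 2↔Bool)
open import Data.Bool using (Bool; true; false; not; if_then_else_)
open import Data.Bool.Properties using (not-involutive; not-injective; not-¬; ¬-not) renaming (_≟_ to _≟ᵇ_)
open import Data.List.Membership.Propositional using (_∈_)
open import Data.List.Relation.Unary.Any using (here; there)
import Data.List.Relation.Unary.All as All
open import Data.Product using (Σ; _×_; _,_; map₂)
open import Data.Sum using (_⊎_; inj₁; inj₂)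
open import Data.Empty using (⊥)
open import Function using (_∘_; Inverse)
open import Relation.Nullary using (¬_; Dec; yes; no; does; ¬?; contradiction)
open import Relation.Nullary.Decidable using (_×-dec_; decidable-stable)
open import Relation.Binary.PropositionalEquality using (_≡_; _≢_; refl; sym; trans; cong; subst)

-- Shortest walks and mutual visibility

module _ {n : ℕ} (G : Graph n) where

  WalkWithin : ℕ → Fin n → Fin n → Set
  WalkWithin k x y = Σ (Walk G x y) λ P → length P ≤ k

  walkWithin? : ∀ k x y → Dec (WalkWithin k x y)
  walkWithin? zero x y with x ≟ y
  ... | yes refl = yes ([] , z≤n)
  ... | no x≢y = no λ { ([] , _) → x≢y refl ; (_ ∷ _ , ()) }
  walkWithin? (suc k) x y with x ≟ y
  ... | yes refl = yes ([] , z≤n)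
  ... | no x≢y with any? (λ z → (adj G x z ≟ᵇ true) ×-dec walkWithin? k z y)
  ...   | yes (_ , xz , P , |P|≤k) = yes (xz ∷ P , s≤s |P|≤k)
  ...   | no ∄z = no λ { ([] , _) → x≢y refl ; (xz ∷ P , s≤s |P|≤k) → ∄z (_ , xz , P , |P|≤k) }

  shortestWalk : ∀ {x y} → Walk G x y → Σ (Walk G x y) IsShortest
  shortestWalk P = shortestWithin (length P) P ≤-refl
    where
    shortestWithin : ∀ k {x y} (P : Walk G x y) → length P ≤ k → Σ (Walk G x y) IsShortest
    shortestWithin zero P |P|≤0 = P , λ Q → ≤-trans |P|≤0 z≤n
    shortestWithin (suc k) {x} {y} P |P|≤1+k with walkWithin? k x y
    ... | yes (Q , |Q|≤k) = shortestWithin k Q |Q|≤k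
    ... | no ∄Q = P , minimal
      where
      minimal : IsShortest P
      minimal Q with length Q ≤? k
      ... | yes |Q|≤k = contradiction (Q , |Q|≤k) ∄Q
      ... | no |Q|≰k = ≤-trans |P|≤1+k (≰⇒> |Q|≰k)

  interior-split : ∀ {x y z} (P : Walk G x y) → z ∈ interior P →
    (Σ (Walk G x z) λ P₁ → length P₁ < length P) × (Σ (Walk G z y) λ P₂ → length P₂ < length P)
  interior-split (xz ∷ (zw ∷ P)) (here refl) = (xz ∷ [] , s≤s (s≤s z≤n)) , (zw ∷ P , n<1+n _)
  interior-split (xw ∷ P@(_ ∷ _)) (there z∈) with interior-split P z∈
  ... | (P₁ , P₁<P) , (P₂ , P₂<P) = (xw ∷ P₁ , s≤s P₁<P) , (P₂ , m<n⇒m<1+n P₂<P)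

  shortest-interior-∉ends : ∀ {x y z} (P : Walk G x y) → IsShortest P → z ∈ interior P →
    ¬ (z ≡ x ⊎ z ≡ y)
  shortest-interior-∉ends P P-shortest z∈ with interior-split P z∈
  ... | (P₁ , P₁<P) , (P₂ , P₂<P) = λ
    { (inj₁ refl) → <⇒≱ P₂<P (P-shortest P₂)
    ; (inj₂ refl) → <⇒≱ P₁<P (P-shortest P₁) }

  visible-⊆ends : Connected G → ∀ (S : Subset n) x y → (∀ z → S z → z ≡ x ⊎ z ≡ y) → Visible G S x y
  visible-⊆ends connected S x y S⊆xy with shortestWalk (connected x y)
  ... | P , P-shortest =
    P , P-shortest , All.tabulate λ {z} z∈ Sz → shortest-interior-∉ends P P-shortest z∈ (S⊆xy z Sz)

  visible-antitone : ∀ {S S' : Subset n} {x y} → (∀ v → S v → S' v) → Visible G S' x y → Visible G S x y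
  visible-antitone S⊆S' (P , P-shortest , avoids) =
    P , P-shortest , All.map (λ ¬S'v Sv → ¬S'v (S⊆S' _ Sv)) avoids

  mutualVisibility-resp : ∀ {S S' : Subset n} → (∀ v → S v → S' v) → (∀ v → S' v → S v) →
    IsMutualVisibility G S → IsMutualVisibility G S'
  mutualVisibility-resp S⊆S' S'⊆S S-mv x y S'x S'y x≢y =
    visible-antitone S'⊆S (S-mv x y (S'⊆S x S'x) (S'⊆S y S'y) x≢y)

  adjacent⇒≢ : ∀ {x y} → adj G x y ≡ true → x ≢ y
  adjacent⇒≢ {x} xy refl with () ← trans (sym xy) (adj-irrefl G x)

  CommonNeighbour : Fin n → Fin n → Set
  CommonNeighbour x y = Σ (Fin n) λ w → adj G x w ≡ true × adj G w y ≡ true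

  CommonNeighbourOutside : Subset n → Fin n → Fin n → Set
  CommonNeighbourOutside S x y = Σ (Fin n) λ w → adj G x w ≡ true × adj G w y ≡ true × ¬ S w

  -- A common neighbour outside S spans a shortest path of length 2 avoiding S.
  mutualVisibility-byCommonNeighbours : ∀ (S : Subset n) →
    (∀ x y → S x → S y → x ≢ y → adj G x y ≡ false → CommonNeighbourOutside S x y) →
    IsMutualVisibility G S
  mutualVisibility-byCommonNeighbours S common x y Sx Sy x≢y with adj G x y in xy
  ... | true = (xy ∷ []) , oneStep , All.[]
    where
    oneStep : IsShortest (xy ∷ [])
    oneStep [] = contradiction refl (adjacent⇒≢ xy)
    oneStep (_ ∷ _) = s≤s z≤n
  ... | false with common x y Sx Sy x≢y xy
  ...   | w , xw , wy , ¬Sw = (xw ∷ (wy ∷ [])) , twoSteps , ¬Sw All.∷ All.[]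
    where
    twoSteps : IsShortest (xw ∷ (wy ∷ []))
    twoSteps [] = contradiction refl x≢y
    twoSteps (xy′ ∷ []) with () ← trans (sym xy′) xy
    twoSteps (_ ∷ (_ ∷ _)) = s≤s (s≤s z≤n)

  boolColouring : (p : Fin n → Bool) → (∀ b → IsMutualVisibility G (λ u → p u ≡ b)) →
    IsMVColoring G 2 (Inverse.from 2↔Bool ∘ p)
  boolColouring p classes-mv i =
    mutualVisibility-resp (λ _ → Inverse.inverseʳ 2↔Bool) (λ _ e → sym (Inverse.inverseˡ 2↔Bool (sym e)))
      (classes-mv (Inverse.to 2↔Bool i))

χμ-minimal : ∀ {n} {G : Graph n} {k j} → IsMVChromaticNumber G k → Σ (Fin n → Fin j) (IsMVColoring G j) →
  k ≤ j
χμ-minimal {k = k} {j} (_ , fewer-impossible) colouring with k ≤? j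
... | yes k≤j = k≤j
... | no k≰j = contradiction colouring (fewer-impossible j (≰⇒> k≰j))

-- Counting

count : ∀ {n} → (Fin n → Bool) → ℕ
count {zero} p = 0
count {suc n} p = if p zero then suc (count (p ∘ suc)) else count (p ∘ suc)

rank : ∀ {n} → (Fin n → Bool) → Fin n → ℕ
rank p zero = 0
rank p (suc u) = if p zero then suc (rank (p ∘ suc) u) else rank (p ∘ suc) u

_─_ : ∀ {n} → (Fin n → Bool) → Fin n → Fin n → Bool
(p ─ m) u = if does (u ≟ m) then false else p u

count-const-true : ∀ n → count {n} (λ _ → true) ≡ n
count-const-true zero = refl
count-const-true (suc n) = cong suc (count-const-true n)

count+count-not : ∀ {n} (p : Fin n → Bool) → count p + count (not ∘ p) ≡ n
count+count-not {zero} p = refl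
count+count-not {suc n} p with p zero | count+count-not (p ∘ suc)
... | true | ih = cong suc ih
... | false | ih = trans (+-suc (count (p ∘ suc)) _) (cong suc ih)

count-─ : ∀ {n} (p : Fin n → Bool) {m} → p m ≡ true → count p ≡ suc (count (p ─ m))
count-─ {suc n} p {zero} pm rewrite pm = refl
count-─ {suc n} p {suc m} pm with p zero
... | true = cong suc (count-─ (p ∘ suc) pm)
... | false = count-─ (p ∘ suc) pm

─-true : ∀ {n} (p : Fin n → Bool) {m u} → p u ≡ true → u ≢ m → (p ─ m) u ≡ true
─-true p {m} {u} pu u≢m with u ≟ m
... | yes u≡m = contradiction u≡m u≢m
... | no _ = pu

─-false : ∀ {n} (p : Fin n → Bool) {m u} → (p ─ m) u ≡ false → p u ≡ false ⊎ u ≡ m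
─-false p {m} {u} e with u ≟ m
... | yes u≡m = inj₂ u≡m
... | no _ = inj₁ e

rank<count : ∀ {n} (p : Fin n → Bool) {u} → p u ≡ true → rank p u < count p
rank<count {suc n} p {zero} pu rewrite pu = s≤s z≤n
rank<count {suc n} p {suc u} pu with p zero
... | true = s≤s (rank<count (p ∘ suc) pu)
... | false = rank<count (p ∘ suc) pu

rank-injective : ∀ {n} (p : Fin n → Bool) {u w} → p u ≡ true → p w ≡ true → rank p u ≡ rank p w → u ≡ w
rank-injective {suc n} p {zero} {zero} _ _ _ = refl
rank-injective {suc n} p {zero} {suc w} pu _ eq rewrite pu = contradiction eq 0≢1+n
rank-injective {suc n} p {suc u} {zero} _ pw eq rewrite pw = contradiction (sym eq) 0≢1+n
rank-injective {suc n} p {suc u} {suc w} pu pw eq with p zero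
... | true = cong suc (rank-injective (p ∘ suc) pu pw (suc-injective eq))
... | false = cong suc (rank-injective (p ∘ suc) pu pw eq)

⌊/2⌋-pigeonhole : ∀ a b c → ⌊ a /2⌋ ≡ ⌊ b /2⌋ → ⌊ b /2⌋ ≡ ⌊ c /2⌋ → a ≡ b ⊎ b ≡ c ⊎ a ≡ c
⌊/2⌋-pigeonhole (suc (suc a)) (suc (suc b)) (suc (suc c)) ab bc
  with ⌊/2⌋-pigeonhole a b c (suc-injective ab) (suc-injective bc)
... | inj₁ refl = inj₁ refl
... | inj₂ (inj₁ refl) = inj₂ (inj₁ refl)
... | inj₂ (inj₂ refl) = inj₂ (inj₂ refl)
⌊/2⌋-pigeonhole 0 0 _ _ _ = inj₁ refl
⌊/2⌋-pigeonhole 1 1 _ _ _ = inj₁ refl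
⌊/2⌋-pigeonhole _ 0 0 _ _ = inj₂ (inj₁ refl)
⌊/2⌋-pigeonhole _ 1 1 _ _ = inj₂ (inj₁ refl)
⌊/2⌋-pigeonhole 0 1 0 _ _ = inj₂ (inj₂ refl)
⌊/2⌋-pigeonhole 1 0 1 _ _ = inj₂ (inj₂ refl)
⌊/2⌋-pigeonhole (suc (suc a)) 0 _ () _
⌊/2⌋-pigeonhole (suc (suc a)) 1 _ () _
⌊/2⌋-pigeonhole 0 (suc (suc b)) _ () _
⌊/2⌋-pigeonhole 1 (suc (suc b)) _ () _
⌊/2⌋-pigeonhole _ 0 (suc (suc c)) _ ()
⌊/2⌋-pigeonhole _ 1 (suc (suc c)) _ ()
⌊/2⌋-pigeonhole _ (suc (suc b)) 0 _ ()
⌊/2⌋-pigeonhole _ (suc (suc b)) 1 _ ()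

⌈m/2⌉+⌈n/2⌉≤⌈1+m+n/2⌉ : ∀ m n → ⌈ m /2⌉ + ⌈ n /2⌉ ≤ ⌈ suc (m + n) /2⌉
⌈m/2⌉+⌈n/2⌉≤⌈1+m+n/2⌉ zero n = ⌊n/2⌋-mono (n≤1+n (suc n))
⌈m/2⌉+⌈n/2⌉≤⌈1+m+n/2⌉ (suc zero) n = ≤-refl
⌈m/2⌉+⌈n/2⌉≤⌈1+m+n/2⌉ (suc (suc m)) n = s≤s (⌈m/2⌉+⌈n/2⌉≤⌈1+m+n/2⌉ m n)

⌊n/2⌋*2≤n : ∀ n → ⌊ n /2⌋ * 2 ≤ n
⌊n/2⌋*2≤n zero = z≤n
⌊n/2⌋*2≤n (suc zero) = z≤n
⌊n/2⌋*2≤n (suc (suc n)) = s≤s (s≤s (⌊n/2⌋*2≤n n))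

3+⌊n/2⌋≤[n+6]/2 : ∀ n → 3 + ⌊ n /2⌋ ≤ (n + 6) / 2
3+⌊n/2⌋≤[n+6]/2 n = begin
  3 + ⌊ n /2⌋           ≡⟨ m*n/n≡m (3 + ⌊ n /2⌋) 2 ⟨
  (6 + ⌊ n /2⌋ * 2) / 2 ≤⟨ /-monoˡ-≤ 2 (+-monoʳ-≤ 6 (⌊n/2⌋*2≤n n)) ⟩
  (6 + n) / 2           ≡⟨ cong (_/ 2) (+-comm 6 n) ⟩
  (n + 6) / 2           ∎
  where open ≤-Reasoning

-- Pairing

-- The vertices of T share the ⌈|T|/2⌉ new colours in pairs, taken in the order of their ranks.
module Pairing {n : ℕ} (G : Graph n) (G-connected : Connected G) (T : Fin n → Bool)
  {s : ℕ} (c₀ : Fin n → Fin s) (c₀-mv : ∀ i → IsMutualVisibility G (λ u → T u ≡ false × c₀ u ≡ i)) where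

  pairs : ℕ
  pairs = ⌈ count T /2⌉

  colourBy : ∀ u b → T u ≡ b → Fin (s + pairs)
  colourBy u true Tu = s ↑ʳ fromℕ< (⌊n/2⌋-mono (s≤s (rank<count T Tu)))
  colourBy u false _ = c₀ u ↑ˡ pairs

  colour : Fin n → Fin (s + pairs)
  colour u = colourBy u (T u) refl

  SameClass : Fin n → Fin n → Set
  SameClass x y =
    (T x ≡ false × T y ≡ false × c₀ x ≡ c₀ y) ⊎ (T x ≡ true × T y ≡ true × ⌊ rank T x /2⌋ ≡ ⌊ rank T y /2⌋)

  sameColour : ∀ {x y} → colour x ≡ colour y → SameClass x y
  sameColour = sameColourBy refl refl
    where
    sameColourBy : ∀ {x y b b′} (Tx : T x ≡ b) (Ty : T y ≡ b′) → colourBy x b Tx ≡ colourBy y b′ Ty →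
      SameClass x y
    sameColourBy {b = true} {true} Tx Ty eq = inj₂ (Tx , Ty , fromℕ<-injective _ _ _ _ (↑ʳ-injective s _ _ eq))
    sameColourBy {b = false} {false} Tx Ty eq = inj₁ (Tx , Ty , ↑ˡ-injective pairs _ _ eq)
    sameColourBy {b = true} {false} _ _ eq
      with () ← trans (sym (splitAt-↑ʳ s pairs _)) (trans (cong (splitAt s) eq) (splitAt-↑ˡ s _ pairs))
    sameColourBy {b = false} {true} _ _ eq
      with () ← trans (sym (splitAt-↑ˡ s _ pairs)) (trans (cong (splitAt s) eq) (splitAt-↑ʳ s pairs _))

  colour-mv : IsMVColoring G (s + pairs) colour
  colour-mv i x y cx cy x≢y with sameColour (trans cx (sym cy))
  ... | inj₁ (Tx , Ty , c₀x≡c₀y) =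
    visible-antitone G inBaseClass (c₀-mv (c₀ x) x y (Tx , refl) (Ty , sym c₀x≡c₀y) x≢y)
    where
    inBaseClass : ∀ v → colour v ≡ i → T v ≡ false × c₀ v ≡ c₀ x
    inBaseClass v cv with sameColour (trans cv (sym cx))
    ... | inj₁ (Tv , _ , c₀v≡c₀x) = Tv , c₀v≡c₀x
    ... | inj₂ (_ , Tx′ , _) with () ← trans (sym Tx′) Tx
  ... | inj₂ (Tx , Ty , x~y) = visible-⊆ends G G-connected _ x y inPair
    where
    inPair : ∀ z → colour z ≡ i → z ≡ x ⊎ z ≡ y
    inPair z cz with sameColour (trans cz (sym cx))
    ... | inj₁ (_ , Tx′ , _) with () ← trans (sym Tx′) Tx
    ... | inj₂ (Tz , _ , z~x) with ⌊/2⌋-pigeonhole (rank T z) (rank T x) (rank T y) z~x x~y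
    ...   | inj₁ z≡x = inj₁ (rank-injective T Tz Tx z≡x)
    ...   | inj₂ (inj₁ x≡y) = contradiction (rank-injective T Tx Ty x≡y) x≢y
    ...   | inj₂ (inj₂ z≡y) = inj₂ (rank-injective T Tz Ty z≡y)

  pairedColouring : Σ (Fin n → Fin (s + pairs)) (IsMVColoring G (s + pairs))
  pairedColouring = colour , colour-mv

open Pairing using (pairedColouring)

isolateAndPair : ∀ {n} (G : Graph n) → Connected G → Fin n →
  Σ (Fin n → Fin (suc ⌊ n /2⌋)) (IsMVColoring G (suc ⌊ n /2⌋))
isolateAndPair {n} G G-connected v =
  subst (λ t → Σ (Fin n → Fin (suc ⌊ t /2⌋)) (IsMVColoring G (suc ⌊ t /2⌋))) |T|+1≡n
    (pairedColouring G G-connected T (λ _ → zero) singleton-mv)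
  where
  T : Fin n → Bool
  T = (λ _ → true) ─ v
  |T|+1≡n : suc (count T) ≡ n
  |T|+1≡n = trans (sym (count-─ (λ _ → true) {v} refl)) (count-const-true n)
  singleton-mv : ∀ i → IsMutualVisibility G (λ u → T u ≡ false × zero ≡ i)
  singleton-mv i x y (Tx , _) (Ty , _) x≢y with ─-false (λ _ → true) Tx | ─-false (λ _ → true) Ty
  ... | inj₂ x≡v | inj₂ y≡v = contradiction (trans x≡v (sym y≡v)) x≢y

-- Complementary graphs

Complementary : ∀ {n} → Graph n → Graph n → Set
Complementary H H' = ∀ x y → x ≢ y → adj H' x y ≡ not (adj H x y)

complement-complementary : ∀ {n} (G : Graph n) → Complementary G (complement G)
complement-complementary G x y x≢y with x ≟ y
... | yes x≡y = contradiction x≡y x≢y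
... | no _ with adj G x y
...   | true = refl
...   | false = refl

complementary-sym : ∀ {n} (H H' : Graph n) → Complementary H H' → Complementary H' H
complementary-sym _ _ H'≈∁H x y x≢y = trans (sym (not-involutive _)) (cong not (sym (H'≈∁H x y x≢y)))

record NordhausGaddumColourings {n : ℕ} (H H' : Graph n) : Set where
  field
    k k' : ℕ
    colouring : Σ (Fin n → Fin k) (IsMVColoring H k)
    colouring' : Σ (Fin n → Fin k') (IsMVColoring H' k')
    bound : k + k' ≤ 3 + ⌊ n /2⌋

swap : ∀ {n} {H H' : Graph n} → NordhausGaddumColourings H H' → NordhausGaddumColourings H' H
swap {n} c = record
  { k = k' ; k' = k ; colouring = colouring' ; colouring' = colouring
  ; bound = subst (_≤ 3 + ⌊ n /2⌋) (+-comm k k') bound }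
  where open NordhausGaddumColourings c

Diameter≤2 : ∀ {n} → Graph n → Set
Diameter≤2 H = ∀ x y → x ≢ y → adj H x y ≡ false → CommonNeighbour H x y

FarPair : ∀ {n} → Graph n → Set
FarPair {n} H = Σ (Fin n) λ x → Σ (Fin n) λ y → x ≢ y × adj H x y ≡ false × ¬ CommonNeighbour H x y

commonNeighbour? : ∀ {n} (H : Graph n) x y → Dec (CommonNeighbour H x y)
commonNeighbour? H x y = any? λ w → (adj H x w ≟ᵇ true) ×-dec (adj H w y ≟ᵇ true)

farPair⊎diameter≤2 : ∀ {n} (H : Graph n) → FarPair H ⊎ Diameter≤2 H
farPair⊎diameter≤2 H
  with any? (λ x → any? λ y → ¬? (x ≟ y) ×-dec (adj H x y ≟ᵇ false) ×-dec ¬? (commonNeighbour? H x y))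
... | yes far = inj₁ far
... | no ¬far = inj₂ λ x y x≢y xy →
  decidable-stable (commonNeighbour? H x y) λ ¬common → ¬far (x , y , x≢y , xy , ¬common)

HasEdgeIn : ∀ {n} → Graph n → (Fin n → Bool) → Set
HasEdgeIn {n} H p = Σ (Fin n) λ x → Σ (Fin n) λ y → p x ≡ true × p y ≡ true × adj H x y ≡ true

Independent : ∀ {n} → Graph n → (Fin n → Bool) → Set
Independent H p = ∀ {x y} → p x ≡ true → p y ≡ true → adj H x y ≡ false

hasEdgeIn⊎independent : ∀ {n} (H : Graph n) (p : Fin n → Bool) → HasEdgeIn H p ⊎ Independent H p
hasEdgeIn⊎independent H p
  with any? (λ x → any? λ y → (p x ≟ᵇ true) ×-dec (p y ≟ᵇ true) ×-dec (adj H x y ≟ᵇ true))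
... | yes edge = inj₁ edge
... | no ¬edge = inj₂ λ {x} {y} px py → ¬-not λ xy → ¬edge (x , y , px , py , xy)

module _ {n : ℕ} {H H' : Graph n} (H'≈∁H : Complementary H H') where

  nonadjacent⇒∁-adjacent : ∀ {x y} → x ≢ y → adj H x y ≡ false → adj H' x y ≡ true
  nonadjacent⇒∁-adjacent {x} {y} x≢y xy = trans (H'≈∁H x y x≢y) (cong not xy)

  ∁-nonadjacent : ∀ {x y} → adj H' x y ≡ false → x ≡ y ⊎ adj H x y ≡ true
  ∁-nonadjacent {x} {y} xy with x ≟ y
  ... | yes x≡y = inj₁ x≡y
  ... | no x≢y = inj₂ (trans (complementary-sym H H' H'≈∁H x y x≢y) (cong not xy))

  farPair⇒colourings : Connected H → FarPair H → NordhausGaddumColourings H H'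
  farPair⇒colourings H-connected (x , y , x≢y , xy , ¬common) = record
    { k = suc ⌊ n /2⌋ ; k' = 2
    ; colouring = isolateAndPair H H-connected x
    ; colouring' = _ , boolColouring H' (adj H' x) (λ b → mutualVisibility-byCommonNeighbours H' _ (common b))
    ; bound = ≤-reflexive (+-comm (suc ⌊ n /2⌋) 2) }
    where
    x∼y : adj H' x y ≡ true
    x∼y = nonadjacent⇒∁-adjacent x≢y xy
    toY : ∀ {u} → adj H' x u ≡ false → adj H' u y ≡ true
    toY {u} xu with ∁-nonadjacent xu
    ... | inj₁ refl = x∼y
    ... | inj₂ xu-in-H with adj H u y in uy
    ...   | true = contradiction (u , xu-in-H , uy) ¬common
    ...   | false = nonadjacent⇒∁-adjacent (λ { refl → not-¬ x∼y xu }) uy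
    common : ∀ b u w → adj H' x u ≡ b → adj H' x w ≡ b → u ≢ w → adj H' u w ≡ false →
      CommonNeighbourOutside H' (λ u → adj H' x u ≡ b) u w
    common true u w xu xw _ _ = x , trans (adj-sym H' u x) xu , xw , not-¬ (adj-irrefl H' x)
    common false u w xu xw _ _ = y , toY xu , trans (adj-sym H' y w) (toY xw) , not-¬ x∼y

  independentCoNeighbourhoods⇒colourings : Connected H' → Diameter≤2 H → ∀ v →
    Independent H (adj H' v) → Independent H' (adj H v) → NordhausGaddumColourings H H'
  independentCoNeighbourhoods⇒colourings H'-connected diameter≤2 v independent independent' = record
    { k = 2 ; k' = suc ⌊ n /2⌋
    ; colouring = _ , boolColouring H (adj H' v) (λ b → mutualVisibility-byCommonNeighbours H _ (common b))
    ; colouring' = isolateAndPair H' H'-connected v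
    ; bound = ≤-refl }
    where
    -- the class of v is {v} ∪ N(v), a clique because N(v) is independent in H'
    common : ∀ b x y → adj H' v x ≡ b → adj H' v y ≡ b → x ≢ y → adj H x y ≡ false →
      CommonNeighbourOutside H (λ u → adj H' v u ≡ b) x y
    common true x y vx vy x≢y xy with diameter≤2 x y x≢y xy
    ... | w , xw , wy = w , xw , wy , λ vw → not-¬ wy (independent vw vy)
    common false x y vx vy x≢y xy with ∁-nonadjacent vx | ∁-nonadjacent vy
    ... | inj₁ refl | inj₁ refl = contradiction refl x≢y
    ... | inj₁ refl | inj₂ vy′ = contradiction xy (not-¬ vy′)
    ... | inj₂ vx′ | inj₁ refl = contradiction xy (not-¬ (trans (adj-sym H x y) vx′))
    ... | inj₂ vx′ | inj₂ vy′ = contradiction (independent' vx′ vy′) (not-¬ (nonadjacent⇒∁-adjacent x≢y xy))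

  edgeInCoNeighbourhood⇒colourings : Connected H → Connected H' → Diameter≤2 H → ∀ v →
    HasEdgeIn H (adj H' v) → NordhausGaddumColourings H H'
  edgeInCoNeighbourhood⇒colourings H-connected H'-connected diameter≤2 v (m₁ , m₂ , vm₁ , vm₂ , m₁m₂) =
    record
    { k = 2 + ⌈ count T₁ /2⌉ ; k' = 1 + ⌈ count T₂ /2⌉
    ; colouring = pairedColouring H H-connected T₁ (Inverse.from 2↔Bool ∘ adj H v) base-mv
    ; colouring' = pairedColouring H' H'-connected T₂ (λ _ → zero) coNeighbourhood-mv
    ; bound = bound }
    where
    N T₁ T₂ : Fin n → Bool
    N = adj H' v
    T₁ = (N ─ m₁) ─ m₂
    T₂ = not ∘ N

    size : 2 + (count T₁ + count T₂) ≡ n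
    size = trans (cong (_+ count T₂) (sym |N|)) (count+count-not N)
      where
      m₂≢m₁ : m₂ ≢ m₁
      m₂≢m₁ refl = adjacent⇒≢ H m₁m₂ refl
      |N| : count N ≡ 2 + count T₁
      |N| = trans (count-─ N vm₁) (cong suc (count-─ (N ─ m₁) (─-true N vm₂ m₂≢m₁)))

    bound : (2 + ⌈ count T₁ /2⌉) + (1 + ⌈ count T₂ /2⌉) ≤ 3 + ⌊ n /2⌋
    bound = begin
      (2 + ⌈ count T₁ /2⌉) + (1 + ⌈ count T₂ /2⌉) ≡⟨ cong (2 +_) (+-suc ⌈ count T₁ /2⌉ ⌈ count T₂ /2⌉) ⟩
      3 + (⌈ count T₁ /2⌉ + ⌈ count T₂ /2⌉)     ≤⟨ +-monoʳ-≤ 3 (⌈m/2⌉+⌈n/2⌉≤⌈1+m+n/2⌉ (count T₁) (count T₂)) ⟩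
      3 + ⌊ 2 + (count T₁ + count T₂) /2⌋       ≡⟨ cong (λ t → 3 + ⌊ t /2⌋) size ⟩
      3 + ⌊ n /2⌋                               ∎
      where open ≤-Reasoning

    outsideT₁ : ∀ {u} → T₁ u ≡ false → adj H v u ≡ false → u ≡ v ⊎ u ≡ m₁ ⊎ u ≡ m₂
    outsideT₁ {u} T₁u vu with ─-false (N ─ m₁) T₁u
    ... | inj₂ u≡m₂ = inj₂ (inj₂ u≡m₂)
    ... | inj₁ [N─m₁]u with ─-false N [N─m₁]u
    ...   | inj₂ u≡m₁ = inj₂ (inj₁ u≡m₁)
    ...   | inj₁ Nu with ∁-nonadjacent Nu
    ...     | inj₁ v≡u = inj₁ (sym v≡u)
    ...     | inj₂ vu′ = contradiction vu (not-¬ vu′)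

    -- the class of v is {v, m₁, m₂}, in which m₁ m₂ is the only edge
    baseCommon : ∀ b x y → T₁ x ≡ false × adj H v x ≡ b → T₁ y ≡ false × adj H v y ≡ b →
      x ≢ y → adj H x y ≡ false →
      CommonNeighbourOutside H (λ u → T₁ u ≡ false × adj H v u ≡ b) x y
    baseCommon true x y (_ , vx) (_ , vy) _ _ =
      v , trans (adj-sym H x v) vx , vy , λ { (_ , vv) → not-¬ vv (adj-irrefl H v) }
    baseCommon false x y (T₁x , vx) (T₁y , vy) x≢y xy with diameter≤2 x y x≢y xy
    ... | w , xw , wy = w , xw , wy , λ { (_ , vw) → v≁w⇒⊥ vw }
      where
      v≁w⇒⊥ : adj H v w ≡ false → ⊥
      v≁w⇒⊥ vw with outsideT₁ T₁x vx | outsideT₁ T₁y vy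
      ... | inj₁ refl | _ = not-¬ xw vw
      ... | _ | inj₁ refl = not-¬ (trans (adj-sym H v w) wy) vw
      ... | inj₂ (inj₁ refl) | inj₂ (inj₁ refl) = x≢y refl
      ... | inj₂ (inj₂ refl) | inj₂ (inj₂ refl) = x≢y refl
      ... | inj₂ (inj₁ refl) | inj₂ (inj₂ refl) = not-¬ m₁m₂ xy
      ... | inj₂ (inj₂ refl) | inj₂ (inj₁ refl) = not-¬ (trans (adj-sym H x y) m₁m₂) xy

    base-mv : ∀ i → IsMutualVisibility H (λ u → T₁ u ≡ false × Inverse.from 2↔Bool (adj H v u) ≡ i)
    base-mv i = mutualVisibility-resp H (λ _ → map₂ (Inverse.inverseʳ 2↔Bool))
      (λ _ → map₂ λ e → sym (Inverse.inverseˡ 2↔Bool (sym e)))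
      (mutualVisibility-byCommonNeighbours H _ (baseCommon (Inverse.to 2↔Bool i)))

    coNeighbourhood-mv : ∀ i → IsMutualVisibility H' (λ u → T₂ u ≡ false × zero ≡ i)
    coNeighbourhood-mv i = mutualVisibility-byCommonNeighbours H' _ λ x y (T₂x , _) (T₂y , _) _ _ →
      v , trans (adj-sym H' x v) (not-injective T₂x) , not-injective T₂y ,
      λ { (T₂v , _) → not-¬ (cong not (adj-irrefl H' v)) T₂v }

nordhausGaddumColourings-from : ∀ {n} {H H' : Graph n} → Complementary H H' → Connected H → Connected H' → Fin n →
  NordhausGaddumColourings H H'
nordhausGaddumColourings-from {H = H} {H'} H'≈∁H H-connected H'-connected v
  with farPair⊎diameter≤2 H | farPair⊎diameter≤2 H'
     | hasEdgeIn⊎independent H (adj H' v) | hasEdgeIn⊎independent H' (adj H v)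
... | inj₁ far | _ | _ | _ = farPair⇒colourings H'≈∁H H-connected far
... | inj₂ _ | inj₁ far | _ | _ = swap (farPair⇒colourings (complementary-sym H H' H'≈∁H) H'-connected far)
... | inj₂ diameter≤2 | _ | inj₁ edge | _ =
  edgeInCoNeighbourhood⇒colourings H'≈∁H H-connected H'-connected diameter≤2 v edge
... | _ | inj₂ diameter≤2 | _ | inj₁ edge =
  swap (edgeInCoNeighbourhood⇒colourings (complementary-sym H H' H'≈∁H) H'-connected H-connected
          diameter≤2 v edge)
... | inj₂ diameter≤2 | _ | inj₂ independent | inj₂ independent' =
  independentCoNeighbourhoods⇒colourings H'≈∁H H'-connected diameter≤2 v independent independent'

nordhausGaddumColourings : ∀ {n} (G : Graph n) → Connected G → Connected (complement G) →
  NordhausGaddumColourings G (complement G)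
nordhausGaddumColourings {zero} G _ _ =
  record { k = 0 ; k' = 0 ; colouring = (λ ()) , (λ ()) ; colouring' = (λ ()) , (λ ()) ; bound = z≤n }
nordhausGaddumColourings {suc n} G G-connected Ḡ-connected =
  nordhausGaddumColourings-from (complement-complementary G) G-connected Ḡ-connected zero

corollary5p10 : ∀ (n : ℕ) (G : Graph n) → Connected G → Connected (complement G) →
    ∀ (k₁ k₂ : ℕ) → IsMVChromaticNumber G k₁ → IsMVChromaticNumber (complement G) k₂ →
      k₁ + k₂ ≤ (n + 6) / 2
corollary5p10 n G G-connected Ḡ-connected k₁ k₂ χμ[G]≡k₁ χμ[Ḡ]≡k₂ = begin
  k₁ + k₂     ≤⟨ +-mono-≤ (χμ-minimal χμ[G]≡k₁ colouring) (χμ-minimal χμ[Ḡ]≡k₂ colouring') ⟩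
  k + k'      ≤⟨ bound ⟩
  3 + ⌊ n /2⌋ ≤⟨ 3+⌊n/2⌋≤[n+6]/2 n ⟩
  (n + 6) / 2 ∎
  where
  open NordhausGaddumColourings (nordhausGaddumColourings G G-connected Ḡ-connected)
  open ≤-Reasoning
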